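{- Let $n \geq 3$ and let $a,b$ be positive integers. If the sequence $(h_0,\ldots,h_n)\in \mathbb{Z}_{>0}^{n+1}$ with $h_0=1$, $h_1=\cdots=h_{n-1}=a$ and $h_n=b$ is a pure $O$-sequence, then $b\leq a$.
   Context: Monomials are in finitely many indeterminates $x_1,\ldots,x_s$ (any $s$), each of degree $1$. An order ideal of monomials is a nonempty finite set $\mathcal{A}$ of monomials such that whenever $u\in\mathcal{A}$ and $v$ is a monomial dividing $u$, then $v\in\mathcal{A}$. It is pure if all its maximal elements with respect to divisibility have the same degree. Its $h$-vector is $h(\mathcal{A})=(h_0,\ldots,h_n)$ where $n=\max\{\deg u: u\in\mathcal{A}\}$ and $h_i$ is the number of elements of $\mathcal{A}$ of degree $i$. A finite sequence of positive integers is a pure $O$-sequence if it equals $h(\mathcal{A})$ for some pure order ideal of monomials $\mathcal{A}$. -}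

module Defs where

open import Data.Nat using (ℕ; zero; suc; _≤_; _<_; _⊔_; _≟_)
open import Data.Vec using (Vec; toList)
open import Data.Nat.ListAction using (sum)
open import Data.Vec.Relation.Binary.Pointwise.Inductive using (Pointwise)
open import Data.List using (List; []; _∷_; map; foldr; length; filter; upTo)
open import Data.List.Membership.Propositional using (_∈_)
open import Data.List.Relation.Unary.Unique.Propositional using (Unique)
open import Data.List.Relation.Unary.All using (All)
open import Data.Product using (Σ; ∃; _×_)
open import Relation.Binary.PropositionalEquality using (_≡_; _≢_)

-- A monomial in x_1..x_s is its exponent vector.
Monomial : ℕ → Set
Monomial s = Vec ℕ s

deg : ∀ {s} → Monomial s → ℕ
deg u = sum (toList u)

_∣ₘ_ : ∀ {s} → Monomial s → Monomial s → Set
v ∣ₘ u = Pointwise _≤_ v u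

record OrderIdeal (s : ℕ) : Set where
  field
    elems     : List (Monomial s)
    unique    : Unique elems
    nonempty  : elems ≢ []
    downClosed : ∀ {u v} → u ∈ elems → v ∣ₘ u → v ∈ elems
open OrderIdeal public

IsMaximal : ∀ {s} → OrderIdeal s → Monomial s → Set
IsMaximal A u = u ∈ elems A × (∀ {v} → v ∈ elems A → u ∣ₘ v → v ≡ u)

IsPure : ∀ {s} → OrderIdeal s → Set
IsPure A = ∀ {u w} → IsMaximal A u → IsMaximal A w → deg u ≡ deg w

maxDeg : ∀ {s} → OrderIdeal s → ℕ
maxDeg A = foldr _⊔_ 0 (map deg (elems A))

hEntry : ∀ {s} → OrderIdeal s → ℕ → ℕ
hEntry A i = length (filter (λ u → deg u ≟ i) (elems A))

hVector : ∀ {s} → OrderIdeal s → List ℕ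
hVector A = map (hEntry A) (upTo (suc (maxDeg A)))

IsPureOSequence : List ℕ → Set
IsPureOSequence h =
  All (0 <_) h × ∃ λ s → Σ (OrderIdeal s) λ A → IsPure A × hVector A ≡ h

module Submission where

-- Call i and j adjacent when x_i x_j ∈ A (a loop when i = j). Give every variable v of A a
-- partner p v, its next neighbour in cyclic order. Then v ↦ x_v x_{p v} is injective: purity and
-- n ≥ 3 put every x_v x_k ∈ A below a degree-n element of A, so two loopless variables choosing
-- each other would share a third neighbour, which the cyclic choice rules out. Hence h₁ ≤ h₂, and
-- h₁ = h₂ makes every x_i x_j ∈ A of the form x_v x_{p v}. This leaves a degree-n element of A
-- only the shapes x_v^n, x_v x_{p v}^(n-1) and x_v x_{p v} x_{p (p v)}, so h_n ≤ h₁.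

open import Defs
open import Data.Nat as ℕ using (ℕ; zero; suc; _+_; _*_; _∸_; _≤_; _<_; _⊔_; z≤n; s≤s; _≤?_; _<?_)
open import Data.Nat.Properties
open import Data.Fin as Fin using (Fin; zero; suc)
import Data.Fin.Properties as Fin
open import Data.Vec as Vec using ([]; _∷_; lookup; tabulate; zipWith)
open import Data.Vec.Properties using (lookup-zipWith; lookup-map; lookup∘tabulate; zipWith-comm)
  renaming (≡-dec to ≡-decᵥ)
import Data.Vec.Properties as Vecₚ
open import Data.Vec.Relation.Binary.Pointwise.Inductive as Pointwise using ([]; _∷_)
import Data.Vec.Relation.Binary.Pointwise.Extensional as Extensional
open import Data.List
  using (List; []; _∷_; length; map; foldr; filter; allFin; applyUpTo; replicate; _++_; _∷ʳ_)
open import Data.List.Properties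
  using ( length-map; ∷-injective; ∷ʳ-injectiveʳ; applyUpTo-∷ʳ; map-applyUpTo
        ; length-applyUpTo; length-++; length-replicate)
open import Data.List.Membership.Propositional using (_∈_)
open import Data.List.Membership.Propositional.Properties
  using (∈-filter⁺; ∈-filter⁻; ∈-map⁺; ∈-map⁻; ∈-allFin)
import Data.List.Membership.DecPropositional as DecMembership
open import Data.List.Relation.Unary.Any using (here; there)
import Data.List.Relation.Unary.All as All
open import Data.List.Relation.Unary.AllPairs using (_∷_)
open import Data.List.Relation.Unary.Unique.Propositional using (Unique)
import Data.List.Relation.Unary.Unique.Propositional.Properties as Unique
open import Data.List.Extrema.Nat using (argmax; argmax-all; f[xs]≤f[argmax])
open import Data.Product using (∃; _×_; _,_; proj₁; proj₂)
open import Data.Sum using (_⊎_; inj₁; inj₂; reduce)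
open import Data.Bool using (if_then_else_)
open import Data.Empty using (⊥; ⊥-elim)
open import Function using (_∘_; id)
open import Relation.Nullary using (¬_; Dec; yes; no; does; contradiction; _×-dec_; ¬?)
open import Relation.Nullary.Decidable using (dec-true; dec-false; decidable-stable)
open import Relation.Binary using (tri<; tri≈; tri>)
open import Relation.Binary.Definitions using (DecidableEquality)
open import Relation.Binary.PropositionalEquality
open import Algebra.Properties.CommutativeSemigroup +-commutativeSemigroup
  using () renaming (interchange to +-interchange)

module _ {A : Set} where

  remove : ∀ {x : A} {ys} → x ∈ ys → List A
  remove {ys = y ∷ ys} (here _)  = ys
  remove {ys = y ∷ ys} (there p) = y ∷ remove p

  length-remove : ∀ {x : A} {ys} (p : x ∈ ys) → suc (length (remove p)) ≡ length ys
  length-remove (here _)  = refl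
  length-remove (there p) = cong suc (length-remove p)

  ∈-remove : ∀ {x y : A} {ys} (p : x ∈ ys) → y ∈ ys → y ≢ x → y ∈ remove p
  ∈-remove (here refl) (here refl) y≢x = contradiction refl y≢x
  ∈-remove (here refl) (there q)   _   = q
  ∈-remove (there p)   (here refl) _   = here refl
  ∈-remove (there p)   (there q)   y≢x = there (∈-remove p q y≢x)

  unique-⊆⇒length≤ : ∀ {xs ys : List A} → Unique xs → (∀ {x} → x ∈ xs → x ∈ ys) →
                     length xs ≤ length ys
  unique-⊆⇒length≤ {[]}     _          _   = z≤n
  unique-⊆⇒length≤ {x ∷ xs} (x∉xs ∷ u) xs⊆ys = subst (suc (length xs) ≤_) (length-remove x∈ys)
      (s≤s (unique-⊆⇒length≤ u λ y∈xs →
        ∈-remove x∈ys (xs⊆ys (there y∈xs)) λ y≡x → All.lookup x∉xs y∈xs (sym y≡x)))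
    where x∈ys = xs⊆ys (here refl)

  unique-⊆-length≥⇒⊇ : DecidableEquality A → ∀ {xs ys : List A} → Unique xs →
                        (∀ {x} → x ∈ xs → x ∈ ys) → length ys ≤ length xs →
                        ∀ {y} → y ∈ ys → y ∈ xs
  unique-⊆-length≥⇒⊇ _≟_ {xs} {ys} u xs⊆ys ys≤xs {y} y∈ys with DecMembership._∈?_ _≟_ y xs
  ... | yes y∈xs = y∈xs
  ... | no  y∉xs = contradiction (≤-trans xs<ys ys≤xs) (<-irrefl refl)
    where
    xs<ys : length xs < length ys
    xs<ys = subst (length xs <_) (length-remove y∈ys) (s≤s (unique-⊆⇒length≤ u λ {x} x∈xs →
      ∈-remove y∈ys (xs⊆ys x∈xs) λ x≡y → y∉xs (subst (_∈ xs) x≡y x∈xs)))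

private variable s : ℕ

infixl 25 _*ₘ_
infixr 26 _^ₘ_

_*ₘ_ : Monomial s → Monomial s → Monomial s
_*ₘ_ = zipWith _+_

_^ₘ_ : Monomial s → ℕ → Monomial s
u ^ₘ k = Vec.map (k *_) u

δ : Fin s → Fin s → ℕ
δ i j = if does (i Fin.≟ j) then 1 else 0

x : Fin s → Monomial s
x i = tabulate (δ i)

lookup-*ₘ : ∀ (u w : Monomial s) j → lookup (u *ₘ w) j ≡ lookup u j + lookup w j
lookup-*ₘ u w j = lookup-zipWith _+_ j u w

lookup-^ₘ : ∀ (u : Monomial s) k j → lookup (u ^ₘ k) j ≡ k * lookup u j
lookup-^ₘ u k j = lookup-map j (k *_) u

lookup-x-≡ : ∀ (i : Fin s) → lookup (x i) i ≡ 1
lookup-x-≡ i with i Fin.≟ i | lookup∘tabulate (δ i) i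
... | yes _   | eq = eq
... | no  i≢i | _  = contradiction refl i≢i

lookup-x-≢ : ∀ {i j : Fin s} → i ≢ j → lookup (x i) j ≡ 0
lookup-x-≢ {i = i} {j} i≢j with i Fin.≟ j | lookup∘tabulate (δ i) j
... | yes i≡j | _  = contradiction i≡j i≢j
... | no  _   | eq = eq

lookup-x-pos : ∀ (i : Fin s) → 1 ≤ lookup (x i) i
lookup-x-pos i = ≤-reflexive (sym (lookup-x-≡ i))

lookup-≤-*ₘˡ : ∀ (u w : Monomial s) j → lookup u j ≤ lookup (u *ₘ w) j
lookup-≤-*ₘˡ u w j = subst (lookup u j ≤_) (sym (lookup-*ₘ u w j)) (m≤m+n _ _)

lookup-≤-*ₘʳ : ∀ (u w : Monomial s) j → lookup w j ≤ lookup (u *ₘ w) j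
lookup-≤-*ₘʳ u w j = subst (lookup w j ≤_) (sym (lookup-*ₘ u w j)) (m≤n+m _ _)

lookup-x*ₘ-pos : ∀ (i : Fin s) w → 1 ≤ lookup (x i *ₘ w) i
lookup-x*ₘ-pos i w = ≤-trans (lookup-x-pos i) (lookup-≤-*ₘˡ (x i) w i)

lookup-*ₘx-pos : ∀ u (j : Fin s) → 1 ≤ lookup (u *ₘ x j) j
lookup-*ₘx-pos u j = ≤-trans (lookup-x-pos j) (lookup-≤-*ₘʳ u (x j) j)

deg-*ₘ : ∀ (u w : Monomial s) → deg (u *ₘ w) ≡ deg u + deg w
deg-*ₘ []      []      = refl
deg-*ₘ (a ∷ u) (b ∷ w) = trans (cong (a + b +_) (deg-*ₘ u w)) (+-interchange a b (deg u) (deg w))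

deg-^ₘ : ∀ (u : Monomial s) k → deg (u ^ₘ k) ≡ k * deg u
deg-^ₘ []      k = sym (*-zeroʳ k)
deg-^ₘ (a ∷ u) k = trans (cong (k * a +_) (deg-^ₘ u k)) (sym (*-distribˡ-+ k a (deg u)))

deg-x : ∀ (i : Fin s) → deg (x i) ≡ 1
deg-x {suc s} zero = cong suc (deg-zeros s)
  where
  deg-zeros : ∀ s → deg (tabulate {n = s} λ _ → 0) ≡ 0
  deg-zeros zero    = refl
  deg-zeros (suc s) = deg-zeros s
deg-x (suc i) = deg-x i

deg-x*x : ∀ (i j : Fin s) → deg (x i *ₘ x j) ≡ 2
deg-x*x i j = trans (deg-*ₘ (x i) (x j)) (cong₂ _+_ (deg-x i) (deg-x j))

lookup-x^ₘ-≡ : ∀ (i : Fin s) k → lookup (x i ^ₘ k) i ≡ k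
lookup-x^ₘ-≡ i k = trans (lookup-^ₘ (x i) k i) (trans (cong (k *_) (lookup-x-≡ i)) (*-identityʳ k))

deg-x^ₘ : ∀ (i : Fin s) k → deg (x i ^ₘ k) ≡ k
deg-x^ₘ i k = trans (deg-^ₘ (x i) k) (trans (cong (k *_) (deg-x i)) (*-identityʳ k))

∣ₘ-intro : ∀ {u w : Monomial s} → (∀ j → 1 ≤ lookup u j → lookup u j ≤ lookup w j) → u ∣ₘ w
∣ₘ-intro {u = u} {w} h = Extensional.extensional⇒inductive (Extensional.ext bound)
  where
  bound : ∀ j → lookup u j ≤ lookup w j
  bound j with lookup u j in eq
  ... | zero  = z≤n
  ... | suc a = subst (_≤ lookup w j) eq (h j (subst (1 ≤_) (sym eq) (s≤s z≤n)))

deg-mono-∣ₘ : ∀ {u w : Monomial s} → u ∣ₘ w → deg u ≤ deg w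
deg-mono-∣ₘ []       = ≤-refl
deg-mono-∣ₘ (a≤b ∷ p) = +-mono-≤ a≤b (deg-mono-∣ₘ p)

∣ₘ∧deg≤⇒≡ : ∀ {u w : Monomial s} → u ∣ₘ w → deg w ≤ deg u → u ≡ w
∣ₘ∧deg≤⇒≡ []                          _  = refl
∣ₘ∧deg≤⇒≡ {u = a ∷ u} {b ∷ w} (a≤b ∷ p) le = cong₂ _∷_ a≡b (∣ₘ∧deg≤⇒≡ p (≤-reflexive (sym u≡w)))
  where
  u≤w = deg-mono-∣ₘ p
  w≤u : deg w ≤ deg u
  w≤u = +-cancelˡ-≤ b _ _ (≤-trans le (+-monoˡ-≤ (deg u) a≤b))
  u≡w = ≤-antisym u≤w w≤u
  a≡b : a ≡ b
  a≡b = ≤-antisym a≤b (+-cancelʳ-≤ (deg u) b a (subst (λ d → b + d ≤ a + deg u) (sym u≡w) le))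

deg<⇒∃-lookup< : ∀ {u w : Monomial s} → deg w < deg u → ∃ λ j → lookup w j < lookup u j
deg<⇒∃-lookup< {u = u} {w} w<u with Fin.any? (λ j → lookup w j <? lookup u j)
... | yes exceeds = exceeds
... | no  none    = contradiction (deg-mono-∣ₘ u∣w) (<⇒≱ w<u)
  where
  u∣w : u ∣ₘ w
  u∣w = ∣ₘ-intro λ j _ → ≮⇒≥ λ w<u → none (j , w<u)

deg-pos⇒∃-lookup-pos : ∀ (u : Monomial s) → 1 ≤ deg u → ∃ λ i → 1 ≤ lookup u i
deg-pos⇒∃-lookup-pos (zero  ∷ u) pos with deg-pos⇒∃-lookup-pos u pos
... | i , ui = suc i , ui
deg-pos⇒∃-lookup-pos (suc a ∷ u) _ = zero , s≤s z≤n

lookup≤deg : ∀ (u : Monomial s) i → lookup u i ≤ deg u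
lookup≤deg (a ∷ u) zero    = m≤m+n a (deg u)
lookup≤deg (a ∷ u) (suc i) = m≤n⇒m≤o+n a (lookup≤deg u i)

lookup+lookup≤deg : ∀ (u : Monomial s) {i k} → i ≢ k → lookup u i + lookup u k ≤ deg u
lookup+lookup≤deg (a ∷ u) {zero}  {zero}  0≢0 = contradiction refl 0≢0
lookup+lookup≤deg (a ∷ u) {zero}  {suc k} _   = +-monoʳ-≤ a (lookup≤deg u k)
lookup+lookup≤deg (a ∷ u) {suc i} {zero}  _   =
  subst (_≤ a + deg u) (+-comm a (lookup u i)) (+-monoʳ-≤ a (lookup≤deg u i))
lookup+lookup≤deg (a ∷ u) {suc i} {suc k} i≢k =
  m≤n⇒m≤o+n a (lookup+lookup≤deg u λ i≡k → i≢k (cong suc i≡k))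

support-x : ∀ {i j : Fin s} → 1 ≤ lookup (x i) j → i ≡ j
support-x {i = i} {j} pos with i Fin.≟ j
... | yes i≡j = i≡j
... | no  i≢j = contradiction (subst (1 ≤_) (lookup-x-≢ i≢j) pos) λ ()

support-x*x : ∀ {i j k : Fin s} → 1 ≤ lookup (x i *ₘ x j) k → i ≡ k ⊎ j ≡ k
support-x*x {i = i} {j} {k} pos with i Fin.≟ k | j Fin.≟ k
... | yes i≡k | _       = inj₁ i≡k
... | no  _   | yes j≡k = inj₂ j≡k
... | no  i≢k | no  j≢k = contradiction (subst (1 ≤_) zero-here pos) λ ()
  where
  zero-here : lookup (x i *ₘ x j) k ≡ 0
  zero-here = trans (lookup-*ₘ (x i) (x j) k) (cong₂ _+_ (lookup-x-≢ i≢k) (lookup-x-≢ j≢k))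

x∣ₘ : ∀ {u : Monomial s} {i} → 1 ≤ lookup u i → x i ∣ₘ u
x∣ₘ {u = u} {i} ui = ∣ₘ-intro bound
  where
  bound : ∀ j → 1 ≤ lookup (x i) j → lookup (x i) j ≤ lookup u j
  bound j pos with refl ← support-x {i = i} pos = subst (_≤ lookup u i) (sym (lookup-x-≡ i)) ui

x*x∣ₘ : ∀ {u : Monomial s} {i j} → i ≢ j → 1 ≤ lookup u i → 1 ≤ lookup u j → x i *ₘ x j ∣ₘ u
x*x∣ₘ {u = u} {i} {j} i≢j ui uj = ∣ₘ-intro bound
  where
  bound : ∀ k → 1 ≤ lookup (x i *ₘ x j) k → lookup (x i *ₘ x j) k ≤ lookup u k
  bound k pos with support-x*x {i = i} {j} pos
  ... | inj₁ refl = subst (_≤ lookup u i)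
    (sym (trans (lookup-*ₘ (x i) (x j) i) (cong₂ _+_ (lookup-x-≡ i) (lookup-x-≢ (i≢j ∘ sym))))) ui
  ... | inj₂ refl = subst (_≤ lookup u j)
    (sym (trans (lookup-*ₘ (x i) (x j) j) (cong₂ _+_ (lookup-x-≢ i≢j) (lookup-x-≡ j)))) uj

x*x∣ₘ-diag : ∀ {u : Monomial s} {i} → 2 ≤ lookup u i → x i *ₘ x i ∣ₘ u
x*x∣ₘ-diag {u = u} {i} ui = ∣ₘ-intro bound
  where
  bound : ∀ k → 1 ≤ lookup (x i *ₘ x i) k → lookup (x i *ₘ x i) k ≤ lookup u k
  bound k pos with reduce (support-x*x {i = i} {i} pos)
  ... | refl = subst (_≤ lookup u i)
    (sym (trans (lookup-*ₘ (x i) (x i) i) (cong₂ _+_ (lookup-x-≡ i) (lookup-x-≡ i)))) ui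

x*x∣ₘ⇒lookup-pos : ∀ {u : Monomial s} {i j} → x i *ₘ x j ∣ₘ u → 1 ≤ lookup u i × 1 ≤ lookup u j
x*x∣ₘ⇒lookup-pos {i = i} {j} xixj∣u =
    ≤-trans (lookup-x*ₘ-pos i (x j)) (Pointwise.lookup xixj∣u i)
  , ≤-trans (lookup-*ₘx-pos (x i) j) (Pointwise.lookup xixj∣u j)

*ₘ-comm : ∀ (u w : Monomial s) → u *ₘ w ≡ w *ₘ u
*ₘ-comm = zipWith-comm +-comm

*ₘ-cancelˡ : ∀ (u : Monomial s) {w w′} → u *ₘ w ≡ u *ₘ w′ → w ≡ w′
*ₘ-cancelˡ []      {[]}    {[]}      _  = refl
*ₘ-cancelˡ (a ∷ u) {b ∷ w} {b′ ∷ w′} eq with Vecₚ.∷-injective eq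
... | b≡b′ , w≡w′ = cong₂ _∷_ (+-cancelˡ-≡ a b b′ b≡b′) (*ₘ-cancelˡ u w≡w′)

x-injective : ∀ {i j : Fin s} → x i ≡ x j → i ≡ j
x-injective {i = i} xi≡xj = sym (support-x (subst (λ u → 1 ≤ lookup u i) xi≡xj (lookup-x-pos i)))

x*x-injective : ∀ {i j k l : Fin s} → x i *ₘ x j ≡ x k *ₘ x l → (i ≡ k × j ≡ l) ⊎ (i ≡ l × j ≡ k)
x*x-injective {i = i} {j} {k} {l} eq
  with support-x*x {i = k} {l} (subst (λ u → 1 ≤ lookup u i) eq (lookup-x*ₘ-pos i (x j)))
... | inj₁ refl = inj₁ (refl , x-injective (*ₘ-cancelˡ (x i) eq))
... | inj₂ refl = inj₂ (refl , x-injective (*ₘ-cancelˡ (x i) (trans eq (*ₘ-comm (x k) (x i)))))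

deg≡1⇒x : ∀ (u : Monomial s) → deg u ≡ 1 → ∃ λ i → x i ≡ u
deg≡1⇒x u deg≡1 with deg-pos⇒∃-lookup-pos u (≤-reflexive (sym deg≡1))
... | i , ui = i , ∣ₘ∧deg≤⇒≡ (x∣ₘ ui) (≤-reflexive (trans deg≡1 (sym (deg-x i))))

∃-second-variable : ∀ (u : Monomial s) {i} → 2 ≤ deg u → lookup u i ≤ 1 →
                    ∃ λ j → j ≢ i × 1 ≤ lookup u j
∃-second-variable u {i} 2≤deg ui≤1
  with deg<⇒∃-lookup< {u = u} {x i} (subst (_< deg u) (sym (deg-x i)) 2≤deg)
... | j , xi<u = j , j≢i , ≤-trans (s≤s z≤n) xi<u
  where
  j≢i : j ≢ i
  j≢i refl = <⇒≱ xi<u (subst (lookup u j ≤_) (sym (lookup-x-≡ j)) ui≤1)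

∃-third-variable : ∀ (u : Monomial s) {i k} → 3 ≤ deg u → lookup u i ≤ 1 → lookup u k ≤ 1 →
                   ∃ λ j → j ≢ i × j ≢ k × 1 ≤ lookup u j
∃-third-variable u {i} {k} 3≤deg ui≤1 uk≤1
  with deg<⇒∃-lookup< {u = u} {x i *ₘ x k} (subst (_< deg u) (sym (deg-x*x i k)) 3≤deg)
... | j , xx<u = j , j≢i , j≢k , ≤-trans (s≤s z≤n) xx<u
  where
  j≢i : j ≢ i
  j≢i refl = <⇒≱ xx<u (≤-trans ui≤1 (lookup-x*ₘ-pos j (x k)))
  j≢k : j ≢ k
  j≢k refl = <⇒≱ xx<u (≤-trans uk≤1 (lookup-*ₘx-pos (x i) j))

least : ∀ {s} {P : Fin s → Set} → (∀ i → Dec (P i)) →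
        (∃ λ i → P i × ∀ {j} → j Fin.< i → ¬ P j) ⊎ (∀ i → ¬ P i)
least {zero}  P? = inj₂ λ ()
least {suc s} P? with P? zero
... | yes P0 = inj₁ (zero , P0 , λ ())
... | no ¬P0 with least (λ i → P? (suc i))
...   | inj₁ (i , Pi , below) =
  inj₁ (suc i , Pi , λ { {zero} _ → ¬P0 ; {suc j} (s≤s j<i) → below j<i })
...   | inj₂ none             = inj₂ λ { zero → ¬P0 ; (suc i) → none i }

module PureOrderIdeal {s} (A : OrderIdeal s) (pure : IsPure A) {n : ℕ} (3≤n : 3 ≤ n)
                      (deg≤n : ∀ {u} → u ∈ elems A → deg u ≤ n)
                      (top : ∃ λ t → t ∈ elems A × deg t ≡ n) where

  _∈A? : (u : Monomial s) → Dec (u ∈ elems A)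
  u ∈A? = DecMembership._∈?_ (≡-decᵥ ℕ._≟_) u (elems A)

  maximal-by-degree : ∀ {u} → u ∈ elems A → (∀ {v} → v ∈ elems A → u ∣ₘ v → deg v ≤ deg u) →
                      IsMaximal A u
  maximal-by-degree u∈A deg≤ = u∈A , λ v∈A u∣v → sym (∣ₘ∧deg≤⇒≡ u∣v (deg≤ v∈A u∣v))

  below-top : ∀ {u} → u ∈ elems A → ∃ λ m → m ∈ elems A × deg m ≡ n × u ∣ₘ m
  below-top {u} u∈A = m , m∈A , trans (pure m-maximal t-maximal) deg-t , u∣m
    where
    t = proj₁ top
    t∈A = proj₁ (proj₂ top)
    deg-t = proj₂ (proj₂ top)
    u∣? = λ w → Pointwise.decidable _≤?_ u w
    multiples : List (Monomial s)
    multiples = filter u∣? (elems A)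
    m = argmax deg u multiples
    m∈A×u∣m : m ∈ elems A × u ∣ₘ m
    m∈A×u∣m = argmax-all deg (u∈A , Pointwise.refl ≤-refl)
      (All.tabulate λ w∈ → ∈-filter⁻ u∣? {xs = elems A} w∈)
    m∈A = proj₁ m∈A×u∣m
    u∣m = proj₂ m∈A×u∣m
    m-maximal : IsMaximal A m
    m-maximal = maximal-by-degree m∈A λ v∈A m∣v →
      All.lookup (f[xs]≤f[argmax] u multiples) (∈-filter⁺ u∣? v∈A (Pointwise.trans ≤-trans u∣m m∣v))
    t-maximal : IsMaximal A t
    t-maximal = maximal-by-degree t∈A λ v∈A _ → subst (_ ≤_) (sym deg-t) (deg≤n v∈A)

  Edge : Fin s → Fin s → Set
  Edge i j = x i *ₘ x j ∈ elems A

  Loop : Fin s → Set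
  Loop i = Edge i i

  Edge? : ∀ i j → Dec (Edge i j)
  Edge? i j = (x i *ₘ x j) ∈A?

  Loop? : ∀ i → Dec (Loop i)
  Loop? i = Edge? i i

  variable∈ : ∀ {u i} → u ∈ elems A → 1 ≤ lookup u i → x i ∈ elems A
  variable∈ u∈A ui = downClosed A u∈A (x∣ₘ ui)

  edge∈ : ∀ {u i j} → u ∈ elems A → i ≢ j → 1 ≤ lookup u i → 1 ≤ lookup u j → Edge i j
  edge∈ u∈A i≢j ui uj = downClosed A u∈A (x*x∣ₘ i≢j ui uj)

  ¬loop⇒lookup≤1 : ∀ {u i} → u ∈ elems A → ¬ Loop i → lookup u i ≤ 1
  ¬loop⇒lookup≤1 {u} {i} u∈A ¬loop with 2 ≤? lookup u i
  ... | yes 2≤ui = contradiction (downClosed A u∈A (x*x∣ₘ-diag 2≤ui)) ¬loop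
  ... | no  2≰ui = ≤-pred (≰⇒> 2≰ui)

  variable-has-edge : ∀ {v} → x v ∈ elems A → ∃ λ j → Edge v j
  variable-has-edge {v} xv∈A with below-top xv∈A
  ... | m , m∈A , deg-m , xv∣m with Loop? v
  ...   | yes loop = v , loop
  ...   | no ¬loop with ∃-second-variable m (subst (2 ≤_) (sym deg-m) (≤-trans (s≤s (s≤s z≤n)) 3≤n))
                                           (¬loop⇒lookup≤1 m∈A ¬loop)
  ...     | j , j≢v , mj = j , edge∈ m∈A (j≢v ∘ sym) mv mj
    where mv = subst (_≤ lookup m v) (lookup-x-≡ v) (Pointwise.lookup xv∣m v)

  data Partner (v : Fin s) : Fin s → Set where
    next     : ∀ {j} → v Fin.≤ j → Edge v j → (∀ {l} → v Fin.≤ l → l Fin.< j → ¬ Edge v l) →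
               Partner v j
    wrap     : ∀ {j} → (∀ {l} → v Fin.≤ l → ¬ Edge v l) → Edge v j →
               (∀ {l} → l Fin.< j → ¬ Edge v l) → Partner v j
    isolated : (∀ j → ¬ Edge v j) → Partner v v

  choosePartner : ∀ v → ∃ (Partner v)
  choosePartner v with least (λ j → (v Fin.≤? j) ×-dec Edge? v j)
  ... | inj₁ (j , (v≤j , e) , below) = j , next v≤j e λ v≤l l<j e′ → below l<j (v≤l , e′)
  ... | inj₂ none-above with least (Edge? v)
  ...   | inj₁ (j , e , below) = j , wrap (λ v≤l e′ → none-above _ (v≤l , e′)) e below
  ...   | inj₂ none            = v , isolated none

  opaque
    partner : Fin s → Fin s
    partner v = proj₁ (choosePartner v)

    partner-spec : ∀ {v j} → partner v ≡ j → Partner v j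
    partner-spec {v} refl = proj₂ (choosePartner v)

  partner-edge : ∀ {v} → x v ∈ elems A → Edge v (partner v)
  partner-edge {v} xv∈A with partner v | partner-spec {v} refl
  ... | _ | next _ e _    = e
  ... | _ | wrap _ e _    = e
  ... | _ | isolated none = let j , e = variable-has-edge {v} xv∈A in contradiction e (none j)

  partner-loop : ∀ {v} → Loop v → partner v ≡ v
  partner-loop {v} loop with partner v | partner-spec {v} refl
  ... | j | next v≤j _ below with v Fin.≟ j
  ...   | yes v≡j = sym v≡j
  ...   | no  v≢j = contradiction loop (below Fin.≤-refl (Fin.≤∧≢⇒< v≤j v≢j))
  partner-loop loop | _ | wrap none-above _ _ = contradiction loop (none-above Fin.≤-refl)
  partner-loop loop | _ | isolated _         = refl

  -- Neither v nor k is looped, so a top-degree multiple of x v *ₘ x k has a third variable l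
  -- adjacent to both; wherever l lies relative to v and k, it violates a minimality condition.
  ¬mutual-partners : ∀ {v k} → v Fin.< k → Partner v k → Partner k v → ⊥
  ¬mutual-partners v<k (next _ _ _)       (next k≤v _ _) = <⇒≱ v<k k≤v
  ¬mutual-partners v<k (wrap none-above e _) _           = none-above (<⇒≤ v<k) e
  ¬mutual-partners v<k (isolated _)       _              = Fin.<-irrefl refl v<k
  ¬mutual-partners v<k (next _ _ _)       (isolated _)   = Fin.<-irrefl refl v<k
  ¬mutual-partners {v} {k} v<k (next _ e below-k) (wrap none-above-k _ below-v)
    with below-top e
  ... | m , m∈A , deg-m , xvxk∣m
    with x*x∣ₘ⇒lookup-pos xvxk∣m
  ... | mv , mk
    with ∃-third-variable m (subst (3 ≤_) (sym deg-m) 3≤n)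
           (¬loop⇒lookup≤1 m∈A (below-k Fin.≤-refl v<k))
           (¬loop⇒lookup≤1 m∈A (none-above-k Fin.≤-refl))
  ... | l , l≢v , l≢k , ml with Fin.<-cmp l k
  ...   | tri≈ _ l≡k _ = l≢k l≡k
  ...   | tri> _ _ k<l = none-above-k (<⇒≤ k<l) (edge∈ m∈A (l≢k ∘ sym) mk ml)
  ...   | tri< l<k _ _ with Fin.<-cmp v l
  ...     | tri≈ _ v≡l _ = l≢v (sym v≡l)
  ...     | tri< v<l _ _ = below-k (<⇒≤ v<l) l<k (edge∈ m∈A (l≢v ∘ sym) mv ml)
  ...     | tri> _ _ l<v = below-v l<v (edge∈ m∈A (l≢k ∘ sym) mk ml)

  partner≡⇒¬loop : ∀ {j v} → partner j ≡ v → j ≢ v → ¬ Loop j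
  partner≡⇒¬loop pj≡v j≢v loop-j = j≢v (trans (sym (partner-loop loop-j)) pj≡v)

  partnerEdge : Fin s → Monomial s
  partnerEdge v = x v *ₘ x (partner v)

  partnerEdge-injective : ∀ {v k} → partnerEdge v ≡ partnerEdge k → v ≡ k
  partnerEdge-injective {v} {k} eq with x*x-injective eq
  ... | inj₁ (v≡k , _)           = v≡k
  ... | inj₂ (v≡pk , pv≡k) with Fin.<-cmp v k
  ...   | tri< v<k _ _ = ⊥-elim (¬mutual-partners v<k (partner-spec pv≡k) (partner-spec (sym v≡pk)))
  ...   | tri≈ _ v≡k _ = v≡k
  ...   | tri> _ _ k<v = ⊥-elim (¬mutual-partners k<v (partner-spec (sym v≡pk)) (partner-spec pv≡k))

  variables : List (Fin s)
  variables = filter (λ i → x i ∈A?) (allFin s)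

  ∈-variables⁻ : ∀ {i} → i ∈ variables → x i ∈ elems A
  ∈-variables⁻ i∈ = proj₂ (∈-filter⁻ (λ i → x i ∈A?) {xs = allFin s} i∈)

  ∈-variables⁺ : ∀ {i} → x i ∈ elems A → i ∈ variables
  ∈-variables⁺ {i} xi∈A = ∈-filter⁺ (λ i → x i ∈A?) (∈-allFin i) xi∈A

  unique-variables : Unique variables
  unique-variables = Unique.filter⁺ (λ i → x i ∈A?) (Unique.allFin⁺ s)

  ofDegree : ℕ → List (Monomial s)
  ofDegree k = filter (λ u → deg u ℕ.≟ k) (elems A)

  unique-ofDegree : ∀ k → Unique (ofDegree k)
  unique-ofDegree k = Unique.filter⁺ (λ u → deg u ℕ.≟ k) (unique A)

  ∈-ofDegree⁻ : ∀ {k u} → u ∈ ofDegree k → u ∈ elems A × deg u ≡ k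
  ∈-ofDegree⁻ {k} = ∈-filter⁻ (λ u → deg u ℕ.≟ k) {xs = elems A}

  ∈-ofDegree⁺ : ∀ {k u} → u ∈ elems A → deg u ≡ k → u ∈ ofDegree k
  ∈-ofDegree⁺ {k} = ∈-filter⁺ (λ u → deg u ℕ.≟ k)

  length-ofDegree1≤length-variables : length (ofDegree 1) ≤ length variables
  length-ofDegree1≤length-variables =
    subst (length (ofDegree 1) ≤_) (length-map x variables)
      (unique-⊆⇒length≤ (unique-ofDegree 1) ⊆xs)
    where
    ⊆xs : ∀ {u} → u ∈ ofDegree 1 → u ∈ map x variables
    ⊆xs {u} u∈ with ∈-ofDegree⁻ u∈
    ... | u∈A , deg≡1 with deg≡1⇒x u deg≡1
    ...   | i , refl = ∈-map⁺ x (∈-variables⁺ {i} u∈A)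

  partnerEdges : List (Monomial s)
  partnerEdges = map partnerEdge variables

  unique-partnerEdges : Unique partnerEdges
  unique-partnerEdges = Unique.map⁺ partnerEdge-injective unique-variables

  partnerEdges⊆ofDegree2 : ∀ {u} → u ∈ partnerEdges → u ∈ ofDegree 2
  partnerEdges⊆ofDegree2 u∈ with ∈-map⁻ partnerEdge u∈
  ... | v , v∈ , refl = ∈-ofDegree⁺ (partner-edge (∈-variables⁻ v∈)) (deg-x*x v (partner v))

  length-variables≤length-ofDegree2 : length variables ≤ length (ofDegree 2)
  length-variables≤length-ofDegree2 =
    subst (_≤ length (ofDegree 2)) (length-map partnerEdge variables)
    (unique-⊆⇒length≤ unique-partnerEdges partnerEdges⊆ofDegree2)

  module Flat (h₂≤h₁ : length (ofDegree 2) ≤ length (ofDegree 1)) where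

    ofDegree2⊆partnerEdges : ∀ {u} → u ∈ ofDegree 2 → u ∈ partnerEdges
    ofDegree2⊆partnerEdges =
      unique-⊆-length≥⇒⊇ (≡-decᵥ ℕ._≟_) unique-partnerEdges partnerEdges⊆ofDegree2
      (subst (length (ofDegree 2) ≤_) (sym (length-map partnerEdge variables))
        (≤-trans h₂≤h₁ length-ofDegree1≤length-variables))

    edge-partner : ∀ {i j} → Edge i j → partner i ≡ j ⊎ partner j ≡ i
    edge-partner {i} {j} e
      with ∈-map⁻ partnerEdge (ofDegree2⊆partnerEdges (∈-ofDegree⁺ e (deg-x*x i j)))
    ... | v , _ , eq with x*x-injective {i = i} {j} {v} {partner v} eq
    ...   | inj₁ (refl , refl) = inj₁ refl
    ...   | inj₂ (refl , refl) = inj₂ refl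

    ¬edge-between-loops : ∀ {i j} → i ≢ j → Loop i → Loop j → ¬ Edge i j
    ¬edge-between-loops i≢j loop-i loop-j e with edge-partner e
    ... | inj₁ pi≡j = i≢j (trans (sym (partner-loop loop-i)) pi≡j)
    ... | inj₂ pj≡i = i≢j (trans (sym pj≡i) (partner-loop loop-j))

    triangle-partner : ∀ {i j k} → i ≢ j → i ≢ k → Edge i j → Edge i k → Edge j k →
                       partner i ≡ j ⊎ partner i ≡ k
    triangle-partner i≢j i≢k eij eik ejk with edge-partner ejk
    ... | inj₁ pj≡k with edge-partner eij
    ...   | inj₁ pi≡j = inj₁ pi≡j
    ...   | inj₂ pj≡i = contradiction (trans (sym pj≡i) pj≡k) i≢k
    triangle-partner i≢j i≢k eij eik ejk | inj₂ pk≡j with edge-partner eik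
    ...   | inj₁ pi≡k = inj₂ pi≡k
    ...   | inj₂ pk≡i = contradiction (trans (sym pk≡i) pk≡j) i≢j

    topMonomial : Fin s → Monomial s
    topMonomial v =
      if does (Loop? v) then x v ^ₘ n
      else if does (Loop? p) then x v *ₘ x p ^ₘ (n ∸ 1)
      else x v *ₘ x p *ₘ x (partner p)
      where p = partner v

    topMonomial-loop : ∀ {v} → Loop v → topMonomial v ≡ x v ^ₘ n
    topMonomial-loop {v} loop-v rewrite dec-true (Loop? v) loop-v = refl

    topMonomial-looped-partner : ∀ {v} → ¬ Loop v → Loop (partner v) →
                                 topMonomial v ≡ x v *ₘ x (partner v) ^ₘ (n ∸ 1)
    topMonomial-looped-partner {v} ¬loop-v loop-p
      rewrite dec-false (Loop? v) ¬loop-v | dec-true (Loop? (partner v)) loop-p = refl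

    topMonomial-loopless-partner : ∀ {v} → ¬ Loop v → ¬ Loop (partner v) →
                                   topMonomial v ≡ x v *ₘ x (partner v) *ₘ x (partner (partner v))
    topMonomial-loopless-partner {v} ¬loop-v ¬loop-p
      rewrite dec-false (Loop? v) ¬loop-v | dec-false (Loop? (partner v)) ¬loop-p = refl

    module TopDegree {m} (m∈A : m ∈ elems A) (deg-m : deg m ≡ n) where

      edge : ∀ {i j} → i ≢ j → 1 ≤ lookup m i → 1 ≤ lookup m j → Edge i j
      edge = edge∈ m∈A

      lookup≤1 : ∀ {i} → ¬ Loop i → lookup m i ≤ 1
      lookup≤1 = ¬loop⇒lookup≤1 m∈A

      3≤deg : 3 ≤ deg m
      3≤deg = subst (3 ≤_) (sym deg-m) 3≤n

      ≡-by-divisibility : ∀ {w} → (∀ j → 1 ≤ lookup m j → lookup m j ≤ lookup w j) → deg w ≤ n →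
                          m ≡ w
      ≡-by-divisibility {w} bound deg-w≤n =
        ∣ₘ∧deg≤⇒≡ (∣ₘ-intro bound) (subst (deg w ≤_) (sym deg-m) deg-w≤n)

      partner-in-support : ∀ {v} → 1 ≤ lookup m v → ¬ Loop v → 1 ≤ lookup m (partner v)
      partner-in-support {v} mv ¬loop-v with 1 ≤? lookup m (partner v)
      ... | yes mp = mp
      ... | no ¬mp with ∃-second-variable m (≤-trans (n≤1+n 2) 3≤deg) (lookup≤1 ¬loop-v)
      ...   | j , j≢v , mj with edge-partner (edge (j≢v ∘ sym) mv mj)
      ...     | inj₁ pv≡j = contradiction (subst (λ i → 1 ≤ lookup m i) (sym pv≡j) mj) ¬mp
      ...     | inj₂ pj≡v
        with ∃-third-variable m 3≤deg (lookup≤1 ¬loop-v) (lookup≤1 (partner≡⇒¬loop pj≡v j≢v))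
      ...       | k , k≢v , k≢j , mk
        with triangle-partner (j≢v ∘ sym) (k≢v ∘ sym)
               (edge (j≢v ∘ sym) mv mj) (edge (k≢v ∘ sym) mv mk) (edge (k≢j ∘ sym) mj mk)
      ...         | inj₁ pv≡j = contradiction (subst (λ i → 1 ≤ lookup m i) (sym pv≡j) mj) ¬mp
      ...         | inj₂ pv≡k = contradiction (subst (λ i → 1 ≤ lookup m i) (sym pv≡k) mk) ¬mp

      all-looped : ∀ {i} → 1 ≤ lookup m i → (∀ j → 1 ≤ lookup m j → Loop j) → m ≡ x i ^ₘ n
      all-looped {i} mi looped = ≡-by-divisibility bound (≤-reflexive (deg-x^ₘ i n))
        where
        bound : ∀ j → 1 ≤ lookup m j → lookup m j ≤ lookup (x i ^ₘ n) j
        bound j mj with i Fin.≟ j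
        ... | yes refl = subst (lookup m i ≤_) (trans deg-m (sym (lookup-x^ₘ-≡ i n))) (lookup≤deg m i)
        ... | no  i≢j  =
          contradiction (edge i≢j mi mj) (¬edge-between-loops i≢j (looped i mi) (looped j mj))

      loopless-looped-partner : ∀ {v} → 1 ≤ lookup m v → ¬ Loop v → Loop (partner v) →
                                m ≡ x v *ₘ x (partner v) ^ₘ (n ∸ 1)
      loopless-looped-partner {v} mv ¬loop-v loop-p = ≡-by-divisibility bound (≤-reflexive deg-w)
        where
        p = partner v
        w = x v *ₘ x p ^ₘ (n ∸ 1)
        mp = partner-in-support mv ¬loop-v
        p≢v : p ≢ v
        p≢v p≡v = ¬loop-v (subst Loop p≡v loop-p)
        deg-w : deg w ≡ n
        deg-w = trans (deg-*ₘ (x v) _) (trans (cong₂ _+_ (deg-x v) (deg-x^ₘ p (n ∸ 1)))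
                  (m+[n∸m]≡n (≤-trans (s≤s z≤n) 3≤n)))
        bound : ∀ j → 1 ≤ lookup m j → lookup m j ≤ lookup w j
        bound j mj with j Fin.≟ v | j Fin.≟ p
        ... | yes refl | _ = ≤-trans (lookup≤1 ¬loop-v) (lookup-x*ₘ-pos v _)
        ... | no  _    | yes refl = begin
          lookup m p                 ≤⟨ m+n≤o⇒m≤o∸n (lookup m p) (lookup+lookup≤deg m p≢v) ⟩
          deg m ∸ lookup m v         ≤⟨ ∸-monoʳ-≤ (deg m) mv ⟩
          deg m ∸ 1                  ≡⟨ cong (_∸ 1) deg-m ⟩
          n ∸ 1                      ≡⟨ lookup-x^ₘ-≡ p (n ∸ 1) ⟨
          lookup (x p ^ₘ (n ∸ 1)) p  ≤⟨ lookup-≤-*ₘʳ (x v) _ p ⟩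
          lookup w p                 ∎
          where open ≤-Reasoning
        ... | no  j≢v  | no  j≢p
          with triangle-partner p≢v (j≢p ∘ sym)
                 (edge p≢v mp mv) (edge (j≢p ∘ sym) mp mj) (edge (j≢v ∘ sym) mv mj)
        ...   | inj₁ pp≡v = ⊥-elim (p≢v (trans (sym (partner-loop loop-p)) pp≡v))
        ...   | inj₂ pp≡j = ⊥-elim (j≢p (trans (sym pp≡j) (partner-loop loop-p)))

      loopless-loopless-partner : ∀ {v} → 1 ≤ lookup m v → ¬ Loop v → ¬ Loop (partner v) →
                                  m ≡ x v *ₘ x (partner v) *ₘ x (partner (partner v))
      loopless-loopless-partner {v} mv ¬loop-v ¬loop-p = ≡-by-divisibility bound (subst (_≤ n) (sym deg-w) 3≤n)
        where
        p = partner v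
        q = partner p
        w = x v *ₘ x p *ₘ x q
        mp = partner-in-support mv ¬loop-v
        mq = partner-in-support mp ¬loop-p
        p≢v : p ≢ v
        p≢v p≡v = ¬loop-v (subst (Edge v) p≡v (partner-edge (variable∈ m∈A mv)))
        q≢p : q ≢ p
        q≢p q≡p = ¬loop-p (subst (Edge p) q≡p (partner-edge (variable∈ m∈A mp)))
        q≢v : q ≢ v
        q≢v q≡v = p≢v (sym (partnerEdge-injective (begin
          x v *ₘ x p  ≡⟨ *ₘ-comm (x v) (x p) ⟩
          x p *ₘ x v  ≡⟨ cong (λ i → x p *ₘ x i) q≡v ⟨
          x p *ₘ x q  ∎)))
          where open ≡-Reasoning
        qq≡v : partner q ≡ v
        qq≡v with edge-partner (edge (q≢v ∘ sym) mv mq)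
        ... | inj₁ p≡q = ⊥-elim (q≢p (sym p≡q))
        ... | inj₂ qq≡v = qq≡v
        ¬loop-q = partner≡⇒¬loop qq≡v q≢v
        deg-w : deg w ≡ 3
        deg-w = trans (deg-*ₘ (x v *ₘ x p) (x q)) (cong₂ _+_ (deg-x*x v p) (deg-x q))
        bound : ∀ j → 1 ≤ lookup m j → lookup m j ≤ lookup w j
        bound j mj with j Fin.≟ v | j Fin.≟ p | j Fin.≟ q
        ... | yes refl | _        | _        = ≤-trans (lookup≤1 ¬loop-v)
          (≤-trans (lookup-x*ₘ-pos v (x p)) (lookup-≤-*ₘˡ (x v *ₘ x p) (x q) v))
        ... | no  _    | yes refl | _        = ≤-trans (lookup≤1 ¬loop-p)
          (≤-trans (lookup-*ₘx-pos (x v) p) (lookup-≤-*ₘˡ (x v *ₘ x p) (x q) p))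
        ... | no  _    | no  _    | yes refl =
          ≤-trans (lookup≤1 ¬loop-q) (lookup-*ₘx-pos (x v *ₘ x p) q)
        ... | no  j≢v  | no  j≢p  | no  j≢q with edge-partner (edge (j≢v ∘ sym) mv mj)
        ...   | inj₁ p≡j = ⊥-elim (j≢p (sym p≡j))
        ...   | inj₂ pj≡v with edge-partner (edge (j≢p ∘ sym) mp mj)
        ...     | inj₁ q≡j  = ⊥-elim (j≢q (sym q≡j))
        ...     | inj₂ pj≡p = ⊥-elim (p≢v (trans (sym pj≡p) pj≡v))

      classify : ∃ λ v → v ∈ variables × m ≡ topMonomial v
      classify with Fin.any? (λ v → (1 ≤? lookup m v) ×-dec ¬? (Loop? v))
      ... | yes (v , mv , ¬loop-v) = v , ∈-variables⁺ (variable∈ m∈A mv) , shape (Loop? (partner v))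
        where
        shape : Dec (Loop (partner v)) → m ≡ topMonomial v
        shape (yes loop-p) = trans (loopless-looped-partner mv ¬loop-v loop-p)
          (sym (topMonomial-looped-partner ¬loop-v loop-p))
        shape (no ¬loop-p) = trans (loopless-loopless-partner mv ¬loop-v ¬loop-p)
          (sym (topMonomial-loopless-partner ¬loop-v ¬loop-p))
      ... | no  none = i , ∈-variables⁺ (variable∈ m∈A mi) ,
                       trans (all-looped mi looped) (sym (topMonomial-loop (looped i mi)))
        where
        looped : ∀ j → 1 ≤ lookup m j → Loop j
        looped j mj = decidable-stable (Loop? j) λ ¬loop → none (j , mj , ¬loop)
        i∈support = deg-pos⇒∃-lookup-pos m (≤-trans (s≤s z≤n) 3≤deg)
        i = proj₁ i∈support
        mi = proj₂ i∈support

    length-ofDegree-n≤length-variables : length (ofDegree n) ≤ length variables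
    length-ofDegree-n≤length-variables =
      subst (length (ofDegree n) ≤_) (length-map topMonomial variables)
      (unique-⊆⇒length≤ (unique-ofDegree n) ⊆topMonomials)
      where
      ⊆topMonomials : ∀ {m} → m ∈ ofDegree n → m ∈ map topMonomial variables
      ⊆topMonomials m∈ with ∈-ofDegree⁻ m∈
      ... | m∈A , deg-m with TopDegree.classify m∈A deg-m
      ...   | v , v∈ , refl = ∈-map⁺ topMonomial v∈

applyUpTo-last : ∀ {X : Set} (f : ℕ → X) m {xs y} → applyUpTo f (suc m) ≡ xs ∷ʳ y → f m ≡ y
applyUpTo-last f m {xs} eq = ∷ʳ-injectiveʳ (applyUpTo f m) xs (trans (applyUpTo-∷ʳ f m) eq)

applyUpTo-flat : ∀ {X : Set} (f : ℕ → X) N k {c a b : X} →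
                 applyUpTo f (suc N) ≡ c ∷ replicate (2 + k) a ++ b ∷ [] →
                 N ≡ 3 + k × f 1 ≡ a × f 2 ≡ a × f (3 + k) ≡ b
applyUpTo-flat f N k {a = a} {b} eq with suc-injective 1+N≡4+k
  where
  open ≡-Reasoning
  1+N≡4+k : suc N ≡ 4 + k
  1+N≡4+k = begin
    suc N                                 ≡⟨ length-applyUpTo f (suc N) ⟨
    length (applyUpTo f (suc N))          ≡⟨ cong length eq ⟩
    3 + length (replicate k a ++ b ∷ [])  ≡⟨ cong (3 +_) (length-++ (replicate k a)) ⟩
    3 + (length (replicate k a) + 1)      ≡⟨ cong (λ l → 3 + (l + 1)) (length-replicate k) ⟩
    3 + (k + 1)                           ≡⟨ cong (3 +_) (+-comm k 1) ⟩
    4 + k                                 ∎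
... | refl with ∷-injective eq
...   | _ , eq₁ with ∷-injective eq₁
...     | f₁≡a , eq₂ with ∷-injective eq₂
...       | f₂≡a , eq₃ = refl , f₁≡a , f₂≡a , applyUpTo-last (λ i → f (3 + i)) k eq₃

deg≤maxDeg : ∀ {s} (A : OrderIdeal s) {u} → u ∈ elems A → deg u ≤ maxDeg A
deg≤maxDeg A u∈A = ≤-foldr-⊔ (∈-map⁺ deg u∈A)
  where
  ≤-foldr-⊔ : ∀ {k ks} → k ∈ ks → k ≤ foldr _⊔_ 0 ks
  ≤-foldr-⊔ {k} {_ ∷ ks} (here refl) = m≤m⊔n k (foldr _⊔_ 0 ks)
  ≤-foldr-⊔ {_} {k ∷ _}  (there p)   = ≤-trans (≤-foldr-⊔ p) (m≤n⊔m k _)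

hEntry-pos⇒∃ : ∀ {s} (A : OrderIdeal s) {k} → 0 < hEntry A k → ∃ λ t → t ∈ elems A × deg t ≡ k
hEntry-pos⇒∃ A {k} pos with filter (λ u → deg u ≟ k) (elems A) in eq
hEntry-pos⇒∃ A {k} () | []
hEntry-pos⇒∃ A {k} _  | t ∷ _ =
  t , ∈-filter⁻ (λ u → deg u ≟ k) {xs = elems A} (subst (t ∈_) (sym eq) (here refl))

lemma1p1 : (n a b : ℕ) → 3 ≤ n → 0 < a → 0 < b →
  IsPureOSequence (1 ∷ (replicate (n ∸ 1) a ++ (b ∷ []))) → b ≤ a
lemma1p1 n@(suc (suc (suc k))) a b 3≤n@(s≤s (s≤s (s≤s _))) _ 0<b (_ , s , A , pure , hv)
  with applyUpTo-flat (hEntry A) (maxDeg A) k (trans (sym (map-applyUpTo id (hEntry A) _)) hv)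
... | maxDeg≡n , h₁≡a , h₂≡a , hₙ≡b =
  subst₂ _≤_ hₙ≡b h₂≡a (≤-trans length-ofDegree-n≤length-variables length-variables≤length-ofDegree2)
  where
  open PureOrderIdeal A pure 3≤n (λ {u} u∈A → subst (deg u ≤_) maxDeg≡n (deg≤maxDeg A u∈A))
                      (hEntry-pos⇒∃ A (subst (0 <_) (sym hₙ≡b) 0<b))
  open Flat (≤-reflexive (trans h₂≡a (sym h₁≡a)))
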